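{- Let $a$ be a positive integer and consider the $a$-$a$ chip-firing game started with $n$ chips at vertex $0$. In the final state, vertex $0$ holds $r$ chips, where $r$ is the remainder of $n$ upon division by $2a$, and each vertex $i$ with $1\le |i|\le \lfloor \frac{n}{2a}\rfloor$ holds exactly $a$ chips.
   Context: The $a$-$a$ chip-firing game on $\mathbb{Z}$: a vertex with at least $2a$ chips may fire, losing $2a$ chips and sending $a$ chips to each of its two neighbors. The final state is the unique configuration reached in which no vertex has at least $2a$ chips. -}

module Defs where

open import Data.Nat using (ℕ; zero; suc; _+_; _*_; _∸_; _≤_; NonZero)
open import Data.Nat.Properties using (m*n≢0)
open import Data.Integer using (ℤ; +_; _≟_) renaming (_+_ to _+ℤ_; _-_ to _-ℤ_)
open import Data.Product using (Σ; _×_)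
open import Relation.Binary.PropositionalEquality using (_≡_)
open import Relation.Binary.Construct.Closure.ReflexiveTransitive using (Star)
open import Relation.Nullary using (yes; no)

Config : Set
Config = ℤ → ℕ

initial : ℕ → Config
initial n x with x ≟ + 0
... | yes _ = n
... | no  _ = 0

fire : ℕ → Config → ℤ → Config
fire a c v x with x ≟ v
... | yes _ = c x ∸ 2 * a
... | no  _ with x ≟ v +ℤ + 1
...   | yes _ = c x + a
...   | no  _ with x ≟ v -ℤ + 1
...     | yes _ = c x + a
...     | no  _ = c x

Step : ℕ → Config → Config → Set
Step a c c' = Σ ℤ (λ v → (2 * a ≤ c v) × (∀ x → c' x ≡ fire a c v x))

Reaches : ℕ → Config → Config → Set
Reaches a = Star (Step a)

Stable : ℕ → Config → Set
Stable a c = ∀ x → c x Data.Nat.< 2 * a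

Final : ℕ → Config → Config → Set
Final a c c' = Reaches a c c' × Stable a c'

twoA≢0 : ∀ a .{{_ : NonZero a}} → NonZero (2 * a)
twoA≢0 a = m*n≢0 2 a

-- Uniqueness is the least action principle: if a legal firing sequence from c
-- ends in a stable configuration, then every legal firing sequence from c fires
-- each vertex at most as often.  Two stable outcomes therefore have the same
-- odometer u, and the conservation law d + 2a·u = c + a·(u(x-1) + u(x+1))
-- recovers d from u.
-- Existence is an explicit schedule.  Adding 2a chips at 0 to the shape with
-- r chips at 0 and a chips at 1 ≤ |x| ≤ q produces the shape for q + 1: round t
-- (t = 0, …, q) fires t, t-1, …, 1, then -t, …, -1, then 0, which moves the two
-- surplus piles of a chips from ±t to ±(t+1).
module Submission where

open import Algebra.Bundles using (CommutativeMonoid)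
import Algebra.Construct.Pointwise as Pointwise
open import Data.Integer using (ℤ; +_; -[1+_]; -_; _≟_; ∣_∣)
  renaming (_+_ to _+ℤ_; _-_ to _-ℤ_)
import Data.Integer.Properties as ℤ
open import Algebra.Properties.AbelianGroup ℤ.+-0-abelianGroup using (∙-cancelˡ)
open import Data.Nat using (ℕ; zero; suc; _+_; _*_; _∸_; _≤_; _<_; z≤n; s≤s; NonZero; >-nonZero⁻¹)
open import Data.Nat.DivMod using (_%_; _/_; m≡m%n+[m/n]*n; m%n<n)
open import Data.Nat.Properties
  using (+-0-commutativeMonoid; +-identityʳ; +-assoc; +-comm; +-suc; *-zeroʳ; *-identityʳ;
         ≤-refl; ≤-trans; ≤-reflexive; ≤-antisym; <⇒≢; <⇒≱; ≤∧≢⇒<; ≤∧≮⇒≡; ≤-<-trans;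
         m<m+n; n≤1+n; m≤m+n; +-monoʳ-≤; *-monoʳ-≤; +-mono-≤; +-cancelʳ-≡; +-cancelʳ-≤;
         +-∸-comm; m∸n+n≡m)
import Data.Nat.Properties as ℕ
open import Algebra.Properties.CommutativeSemigroup ℕ.+-commutativeSemigroup using (xy∙z≈xz∙y)
open import Data.Nat.Solver using (module +-*-Solver)
open import Data.Nat.Tactic.RingSolver using (solve-∀)
open import Data.Product using (Σ; _×_; _,_; proj₁; proj₂)
open import Function.Definitions using (Injective)
open import Relation.Binary.Bundles using (Preorder)
open import Relation.Binary.Construct.Closure.ReflexiveTransitive using (ε; _◅_; _◅◅_; gmap)
open import Relation.Binary.PropositionalEquality
open import Relation.Nullary using (yes; no; contradiction)
open import Defs

open +-*-Solver using (solve; _:=_; _:+_; _:*_; con)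

infixr 6 _⊕_
infix 4 _≈_ _≤̇_

_⊕_ : Config → Config → Config
(c ⊕ d) x = c x + d x

∅ : Config
∅ _ = 0

_≈_ : Config → Config → Set
c ≈ d = ∀ x → c x ≡ d x

_≤̇_ : Config → Config → Set
c ≤̇ d = ∀ x → c x ≤ d x

⊕-commutativeMonoid : CommutativeMonoid _ _
⊕-commutativeMonoid = Pointwise.commutativeMonoid ℤ +-0-commutativeMonoid

open import Algebra.Solver.CommutativeMonoid ⊕-commutativeMonoid
  using (_⊜_; id) renaming (solve to ⊕-solve; _⊕_ to _⊞_)

⊕-congˡ : ∀ c {d d'} → d ≈ d' → c ⊕ d ≈ c ⊕ d'
⊕-congˡ c d≈d' x = cong (_+_ (c x)) (d≈d' x)

opaque
  pile : ℕ → ℤ → Config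
  pile m v x with x ≟ v
  ... | yes _ = m
  ... | no  _ = 0

  pile-self : ∀ m v → pile m v v ≡ m
  pile-self m v with v ≟ v
  ... | yes _   = refl
  ... | no  v≢v = contradiction refl v≢v

  pile-other : ∀ m {v x} → x ≢ v → pile m v x ≡ 0
  pile-other m {v} {x} x≢v with x ≟ v
  ... | yes x≡v = contradiction x≡v x≢v
  ... | no  _   = refl

  pile-transport : ∀ m {v w x y} → (x ≡ v → y ≡ w) → (y ≡ w → x ≡ v) → pile m v x ≡ pile m w y
  pile-transport m {v} {w} {x} {y} to from with x ≟ v | y ≟ w
  ... | yes _   | yes _   = refl
  ... | no  _   | no  _   = refl
  ... | yes x≡v | no  y≢w = contradiction (to x≡v) y≢w
  ... | no  x≢v | yes y≡w = contradiction (from y≡w) x≢v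

  pile-+ : ∀ m n v → pile (m + n) v ≈ pile m v ⊕ pile n v
  pile-+ m n v x with x ≟ v
  ... | yes _ = refl
  ... | no  _ = refl

  pile-scale : ∀ m v x → pile m v x ≡ m * pile 1 v x
  pile-scale m v x with x ≟ v
  ... | yes _ = sym (*-identityʳ m)
  ... | no  _ = sym (*-zeroʳ m)

  initial≈pile : ∀ n → initial n ≈ pile n (+ 0)
  initial≈pile n x with x ≟ + 0
  ... | yes _ = refl
  ... | no  _ = refl

i-1+1≡i : ∀ i → (i -ℤ + 1) +ℤ + 1 ≡ i
i-1+1≡i i = trans (ℤ.+-assoc i (- + 1) (+ 1)) (ℤ.+-identityʳ i)

i+1-1≡i : ∀ i → (i +ℤ + 1) -ℤ + 1 ≡ i
i+1-1≡i i = trans (ℤ.+-assoc i (+ 1) (- + 1)) (ℤ.+-identityʳ i)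

pile-pred : ∀ m v x → pile m v (x -ℤ + 1) ≡ pile m (v +ℤ + 1) x
pile-pred m v x = pile-transport m
  (λ x-1≡v → trans (sym (i-1+1≡i x)) (cong (_+ℤ + 1) x-1≡v))
  (λ x≡v+1 → trans (cong (_-ℤ + 1) x≡v+1) (i+1-1≡i v))

pile-succ : ∀ m v x → pile m v (x +ℤ + 1) ≡ pile m (v -ℤ + 1) x
pile-succ m v x = pile-transport m
  (λ x+1≡v → trans (sym (i+1-1≡i x)) (cong (_-ℤ + 1) x+1≡v))
  (λ x≡v-1 → trans (cong (_+ℤ + 1) x≡v-1) (i-1+1≡i v))

shift-≢ : ∀ v {p q} → p ≢ q → v +ℤ p ≢ v +ℤ q
shift-≢ v p≢q e = p≢q (∙-cancelˡ v _ _ e)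

v≢v+1 : ∀ v → v ≢ v +ℤ + 1
v≢v+1 v e = shift-≢ v (λ ()) (trans (ℤ.+-identityʳ v) e)

v≢v-1 : ∀ v → v ≢ v -ℤ + 1
v≢v-1 v e = shift-≢ v (λ ()) (trans (ℤ.+-identityʳ v) e)

v+1≢v-1 : ∀ v → v +ℤ + 1 ≢ v -ℤ + 1
v+1≢v-1 v = shift-≢ v (λ ())

-[1+k]+1 : ∀ k → -[1+ k ] +ℤ + 1 ≡ - (+ k)
-[1+k]+1 zero    = refl
-[1+k]+1 (suc k) = refl

module Game (a : ℕ) where

  -- Firing each vertex x exactly u x times turns c into d.
  Fires : Config → Config → Config → Set
  Fires u c d = ∀ x → d x + 2 * a * u x ≡ c x + a * (u (x -ℤ + 1) + u (x +ℤ + 1))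

  Fires-∅ : ∀ c → Fires ∅ c c
  Fires-∅ c x = trans (cong (_+_ (c x)) (*-zeroʳ (2 * a))) (sym (cong (_+_ (c x)) (*-zeroʳ a)))

  Fires-⊕ : ∀ {u w c c' d} → Fires u c c' → Fires w c' d → Fires (u ⊕ w) c d
  Fires-⊕ {u} {w} {c} {c'} {d} c→c' c'→d x = begin
      d x + 2 * a * (u x + w x)
    ≡⟨ solve 4 (λ d u w a → d :+ con 2 :* a :* (u :+ w) := (d :+ con 2 :* a :* w) :+ con 2 :* a :* u)
         refl (d x) (u x) (w x) a ⟩
      (d x + 2 * a * w x) + 2 * a * u x
    ≡⟨ cong (_+ 2 * a * u x) (c'→d x) ⟩
      c' x + a * (w⁻ + w⁺) + 2 * a * u x
    ≡⟨ solve 5 (λ c' u a w⁻ w⁺ → c' :+ a :* (w⁻ :+ w⁺) :+ con 2 :* a :* u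
                                := (c' :+ con 2 :* a :* u) :+ a :* (w⁻ :+ w⁺))
         refl (c' x) (u x) a w⁻ w⁺ ⟩
      (c' x + 2 * a * u x) + a * (w⁻ + w⁺)
    ≡⟨ cong (_+ a * (w⁻ + w⁺)) (c→c' x) ⟩
      c x + a * (u⁻ + u⁺) + a * (w⁻ + w⁺)
    ≡⟨ solve 6 (λ c a u⁻ u⁺ w⁻ w⁺ → c :+ a :* (u⁻ :+ u⁺) :+ a :* (w⁻ :+ w⁺)
                                   := c :+ a :* ((u⁻ :+ w⁻) :+ (u⁺ :+ w⁺)))
         refl (c x) a u⁻ u⁺ w⁻ w⁺ ⟩
      c x + a * ((u⁻ + w⁻) + (u⁺ + w⁺)) ∎
    where
    open ≡-Reasoning
    u⁻ = u (x -ℤ + 1)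
    u⁺ = u (x +ℤ + 1)
    w⁻ = w (x -ℤ + 1)
    w⁺ = w (x +ℤ + 1)

  fire-Fires : ∀ {c v} → 2 * a ≤ c v → Fires (pile 1 v) c (fire a c v)
  fire-Fires {c} {v} 2a≤cv x rewrite pile-pred 1 v x | pile-succ 1 v x with x ≟ v
  ... | yes refl
    rewrite pile-self 1 v | pile-other 1 (v≢v+1 v) | pile-other 1 (v≢v-1 v) =
    trans (cong (_+_ (c v ∸ 2 * a)) (*-identityʳ (2 * a)))
          (trans (m∸n+n≡m 2a≤cv) (sym (trans (cong (_+_ (c v)) (*-zeroʳ a)) (+-identityʳ (c v)))))
  ... | no x≢v with x ≟ v +ℤ + 1
  ...   | yes refl
    rewrite pile-other 1 x≢v | pile-self 1 (v +ℤ + 1) | pile-other 1 (v+1≢v-1 v) =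
    solve 2 (λ c a → c :+ a :+ con 2 :* a :* con 0 := c :+ a :* (con 1 :+ con 0)) refl (c x) a
  ...   | no x≢v+1 with x ≟ v -ℤ + 1
  ...     | yes refl rewrite pile-other 1 x≢v | pile-other 1 x≢v+1 | pile-self 1 (v -ℤ + 1) =
    solve 2 (λ c a → c :+ a :+ con 2 :* a :* con 0 := c :+ a :* (con 0 :+ con 1)) refl (c x) a
  ...     | no x≢v-1 rewrite pile-other 1 x≢v | pile-other 1 x≢v+1 | pile-other 1 x≢v-1 =
    solve 2 (λ c a → c :+ con 2 :* a :* con 0 := c :+ a :* (con 0 :+ con 0)) refl (c x) a

  Step-Fires : ∀ {c d} (step : Step a c d) → Fires (pile 1 (proj₁ step)) c d
  Step-Fires {c} (v , 2a≤cv , d≈fire) x =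
    trans (cong (_+ 2 * a * pile 1 v x) (d≈fire x)) (fire-Fires 2a≤cv x)

  odometer : ∀ {c d} → Reaches a c d → Config
  odometer ε               = ∅
  odometer ((v , _) ◅ run) = pile 1 v ⊕ odometer run

  Reaches-Fires : ∀ {c d} (run : Reaches a c d) → Fires (odometer run) c d
  Reaches-Fires {c} ε          = Fires-∅ c
  Reaches-Fires (step ◅ run) = Fires-⊕ (Step-Fires step) (Reaches-Fires run)

  Fires-functional : ∀ {u u' c d e} → Fires u c d → Fires u' c e → u ≈ u' → d ≈ e
  Fires-functional {u} {u'} {c} {d} {e} c→d c→e u≈u' x = +-cancelʳ-≡ _ (d x) (e x) (begin
      d x + 2 * a * u x
    ≡⟨ c→d x ⟩
      c x + a * (u (x -ℤ + 1) + u (x +ℤ + 1))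
    ≡⟨ cong₂ (λ m n → c x + a * (m + n)) (u≈u' _) (u≈u' _) ⟩
      c x + a * (u' (x -ℤ + 1) + u' (x +ℤ + 1))
    ≡⟨ c→e x ⟨
      e x + 2 * a * u' x
    ≡⟨ cong (λ m → e x + 2 * a * m) (u≈u' x) ⟨
      e x + 2 * a * u x ∎)
    where open ≡-Reasoning

  Fires-mono-at-tie : ∀ {p u c d e} v → Fires p c d → Fires u c e → p ≤̇ u → p v ≡ u v → d v ≤ e v
  Fires-mono-at-tie {p} {u} {c} {d} {e} v c→d c→e p≤u pv≡uv = +-cancelʳ-≤ (2 * a * p v) (d v) (e v) (begin
      d v + 2 * a * p v
    ≡⟨ c→d v ⟩
      c v + a * (p (v -ℤ + 1) + p (v +ℤ + 1))
    ≤⟨ +-monoʳ-≤ (c v) (*-monoʳ-≤ a (+-mono-≤ (p≤u _) (p≤u _))) ⟩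
      c v + a * (u (v -ℤ + 1) + u (v +ℤ + 1))
    ≡⟨ c→e v ⟨
      e v + 2 * a * u v
    ≡⟨ cong (λ m → e v + 2 * a * m) pv≡uv ⟨
      e v + 2 * a * p v ∎)
    where open ℕ.≤-Reasoning

  least-action : ∀ {u p c c' d e} → Fires u c e → Stable a e → Fires p c c' → p ≤̇ u →
                 (run : Reaches a c' d) → p ⊕ odometer run ≤̇ u
  least-action c→e stable c→c' p≤u ε x = ≤-trans (≤-reflexive (+-identityʳ _)) (p≤u x)
  least-action {u} {p} c→e stable c→c' p≤u (step@(v , 2a≤c'v , _) ◅ run) x =
    ≤-trans (≤-reflexive (sym (+-assoc (p x) (pile 1 v x) (odometer run x))))
            (least-action c→e stable (Fires-⊕ c→c' (Step-Fires step)) p+v≤u run x)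
    where
    pv<uv : p v < u v
    pv<uv with p v ℕ.<? u v
    ... | yes pv<uv = pv<uv
    ... | no  pv≮uv = contradiction
      (≤-trans 2a≤c'v (Fires-mono-at-tie v c→c' c→e p≤u (≤∧≮⇒≡ (p≤u v) pv≮uv)))
      (<⇒≱ (stable v))
    p+v≤u : p ⊕ pile 1 v ≤̇ u
    p+v≤u y with y ≟ v
    ... | yes refl rewrite pile-self 1 y = ≤-trans (≤-reflexive (+-comm (p y) 1)) pv<uv
    ... | no  y≢v  rewrite pile-other 1 y≢v = ≤-trans (≤-reflexive (+-identityʳ (p y))) (p≤u y)

  final-unique : ∀ {c d e} → Final a c d → Final a c e → d ≈ e
  final-unique {c} (run₁ , stable₁) (run₂ , stable₂) =
    Fires-functional (Reaches-Fires run₁) (Reaches-Fires run₂)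
      (λ x → ≤-antisym (bounded run₂ stable₂ run₁ x) (bounded run₁ stable₁ run₂ x))
    where
    bounded : ∀ {d e} (to-e : Reaches a c e) → Stable a e →
              (run : Reaches a c d) → odometer run ≤̇ odometer to-e
    bounded to-e stable run = least-action (Reaches-Fires to-e) stable (Fires-∅ c) (λ _ → z≤n) run

  infix 4 _↠_
  _↠_ : Config → Config → Set
  c ↠ d = Σ Config λ d' → Reaches a c d' × d' ≈ d

  fire-cong : ∀ {c c'} v x → c x ≡ c' x → fire a c v x ≡ fire a c' v x
  fire-cong v x cx≡c'x with x ≟ v
  ... | yes _ = cong (_∸ 2 * a) cx≡c'x
  ... | no  _ with x ≟ v +ℤ + 1
  ...   | yes _ = cong (_+ a) cx≡c'x
  ...   | no  _ with x ≟ v -ℤ + 1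
  ...     | yes _ = cong (_+ a) cx≡c'x
  ...     | no  _ = cx≡c'x

  ↠-respˡ : ∀ {c c' d} → c ≈ c' → c' ↠ d → c ↠ d
  ↠-respˡ c≈c' (_ , ε , c'≈d) = _ , ε , λ x → trans (c≈c' x) (c'≈d x)
  ↠-respˡ c≈c' (d' , (v , 2a≤c'v , c₁≈fire) ◅ run , d'≈d) =
    d' , (v , subst (2 * a ≤_) (sym (c≈c' v)) 2a≤c'v ,
          λ x → trans (c₁≈fire x) (fire-cong v x (sym (c≈c' x)))) ◅ run , d'≈d

  ≈⇒↠ : ∀ {c d} → c ≈ d → c ↠ d
  ≈⇒↠ c≈d = _ , ε , c≈d

  ↠-trans : ∀ {c d e} → c ↠ d → d ↠ e → c ↠ e
  ↠-trans (d' , run , d'≈d) d↠e with ↠-respˡ d'≈d d↠e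
  ... | e' , run' , e'≈e = e' , run ◅◅ run' , e'≈e

  ↠-preorder : Preorder _ _ _
  ↠-preorder = record
    { Carrier    = Config
    ; _≈_        = _≈_
    ; _≲_        = _↠_
    ; isPreorder = record
      { isEquivalence = CommutativeMonoid.isEquivalence ⊕-commutativeMonoid
      ; reflexive     = ≈⇒↠
      ; trans         = ↠-trans
      }
    }

  open import Relation.Binary.Reasoning.Preorder ↠-preorder

  fire-⊕ʳ : ∀ {c e v} → 2 * a ≤ c v → ∀ x → fire a (c ⊕ e) v x ≡ fire a c v x + e x
  fire-⊕ʳ {c} {e} {v} 2a≤cv x with x ≟ v
  ... | yes refl = +-∸-comm (e x) 2a≤cv
  ... | no  _ with x ≟ v +ℤ + 1
  ...   | yes _ = xy∙z≈xz∙y (c x) (e x) a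
  ...   | no  _ with x ≟ v -ℤ + 1
  ...     | yes _ = xy∙z≈xz∙y (c x) (e x) a
  ...     | no  _ = refl

  ↠-⊕ʳ : ∀ {c d} e → c ↠ d → c ⊕ e ↠ d ⊕ e
  ↠-⊕ʳ e (d' , run , d'≈d) =
    d' ⊕ e , gmap (_⊕ e) step-⊕ʳ run , λ x → cong (_+ e x) (d'≈d x)
    where
    step-⊕ʳ : ∀ {c d} → Step a c d → Step a (c ⊕ e) (d ⊕ e)
    step-⊕ʳ {c} (v , 2a≤cv , d≈fire) =
      v , ≤-trans 2a≤cv (m≤m+n (c v) (e v)) ,
      λ x → trans (cong (_+ e x) (d≈fire x)) (sym (fire-⊕ʳ 2a≤cv x))

  ↠-⊕ˡ : ∀ {c d} e → c ↠ d → e ⊕ c ↠ e ⊕ d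
  ↠-⊕ˡ {c} {d} e c↠d =
    ↠-respˡ (λ x → +-comm (e x) (c x)) (↠-trans (↠-⊕ʳ e c↠d) (≈⇒↠ λ x → +-comm (d x) (e x)))

  ↠-respʳ : ∀ {c d d'} → c ↠ d → d ≈ d' → c ↠ d'
  ↠-respʳ c↠d d≈d' = ↠-trans c↠d (≈⇒↠ d≈d')

  ↠-Final : ∀ {c d} → c ↠ d → Stable a d → Σ Config λ d' → Final a c d' × d' ≈ d
  ↠-Final (d' , run , d'≈d) stable =
    d' , (run , λ x → subst (_< 2 * a) (sym (d'≈d x)) (stable x)) , d'≈d

  aAt : ℤ → Config
  aAt = pile a

  fire-pair : ∀ v → aAt v ⊕ aAt v ↠ aAt (v -ℤ + 1) ⊕ aAt (v +ℤ + 1)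
  fire-pair v = fire a c v , (v , 2a≤cv , λ _ → refl) ◅ ε ,
    Fires-functional (fire-Fires 2a≤cv) c→neighbours (λ _ → refl)
    where
    c = aAt v ⊕ aAt v
    2a≤cv : 2 * a ≤ c v
    2a≤cv = ≤-reflexive (sym (trans (cong₂ _+_ (pile-self a v) (pile-self a v))
                                    (cong (_+_ a) (sym (+-identityʳ a)))))
    c→neighbours : Fires (pile 1 v) c (aAt (v -ℤ + 1) ⊕ aAt (v +ℤ + 1))
    c→neighbours x
      rewrite pile-pred 1 v x | pile-succ 1 v x
            | pile-scale a v x | pile-scale a (v -ℤ + 1) x | pile-scale a (v +ℤ + 1) x =
      solve 4 (λ a δ δ⁻ δ⁺ → a :* δ⁻ :+ a :* δ⁺ :+ con 2 :* a :* δ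
                          := a :* δ :+ a :* δ :+ a :* (δ⁺ :+ δ⁻))
        refl a (pile 1 v x) (pile 1 (v -ℤ + 1) x) (pile 1 (v +ℤ + 1) x)

  module Segment (line : ℕ → ℤ) where

    seg : ℕ → ℕ → Config
    seg i zero    = ∅
    seg i (suc m) = aAt (line i) ⊕ seg (suc i) m

    seg-snoc : ∀ i m → seg i (suc m) ≈ seg i m ⊕ aAt (line (i + m))
    seg-snoc i zero x rewrite +-identityʳ i = +-identityʳ (aAt (line i) x)
    seg-snoc i (suc m) x rewrite seg-snoc (suc i) m x | +-suc i m =
      sym (+-assoc (aAt (line i) x) _ _)

    sweep : (∀ k → aAt (line (suc k)) ⊕ aAt (line (suc k)) ↠ aAt (line k) ⊕ aAt (line (2 + k))) →
            ∀ t → aAt (line t) ⊕ seg 1 t ↠ aAt (line 0) ⊕ seg 2 t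
    sweep fire-line zero    = ≈⇒↠ λ _ → refl
    sweep fire-line (suc t) = begin
        aAt (line (suc t)) ⊕ seg 1 (suc t)
      ≈⟨ ⊕-congˡ (aAt (line (suc t))) (seg-snoc 1 t) ⟩
        aAt (line (suc t)) ⊕ (seg 1 t ⊕ aAt (line (suc t)))
      ≈⟨ ⊕-solve 2 (λ p s → p ⊞ (s ⊞ p) ⊜ (p ⊞ p) ⊞ s) (λ _ → refl)
           (aAt (line (suc t))) (seg 1 t) ⟩
        (aAt (line (suc t)) ⊕ aAt (line (suc t))) ⊕ seg 1 t
      ≲⟨ ↠-⊕ʳ (seg 1 t) (fire-line t) ⟩
        (aAt (line t) ⊕ aAt (line (2 + t))) ⊕ seg 1 t
      ≈⟨ ⊕-solve 3 (λ p q s → (p ⊞ q) ⊞ s ⊜ (p ⊞ s) ⊞ q) (λ _ → refl)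
           (aAt (line t)) (aAt (line (2 + t))) (seg 1 t) ⟩
        (aAt (line t) ⊕ seg 1 t) ⊕ aAt (line (2 + t))
      ≲⟨ ↠-⊕ʳ (aAt (line (2 + t))) (sweep fire-line t) ⟩
        (aAt (line 0) ⊕ seg 2 t) ⊕ aAt (line (2 + t))
      ≈⟨ ⊕-solve 3 (λ p s q → (p ⊞ s) ⊞ q ⊜ p ⊞ (s ⊞ q)) (λ _ → refl)
           (aAt (line 0)) (seg 2 t) (aAt (line (2 + t))) ⟩
        aAt (line 0) ⊕ (seg 2 t ⊕ aAt (line (2 + t)))
      ≈⟨ ⊕-congˡ (aAt (line 0)) (seg-snoc 2 t) ⟨
        aAt (line 0) ⊕ seg 2 (suc t) ∎

    seg-off : ∀ i m {x} → (∀ k → i ≤ k → line k ≢ x) → seg i m x ≡ 0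
    seg-off i zero    off = refl
    seg-off i (suc m) off =
      cong₂ _+_ (pile-other a (λ x≡line-i → off i ≤-refl (sym x≡line-i)))
                (seg-off (suc i) m (λ k i<k → off k (≤-trans (n≤1+n i) i<k)))

    module _ (injective : Injective _≡_ _≡_ line) where

      seg-≤ : ∀ i m x → seg i m x ≤ a
      seg-≤ i zero    x = z≤n
      seg-≤ i (suc m) x with x ≟ line i
      ... | yes refl rewrite pile-self a (line i) | seg-off (suc i) m (λ k i<k e → <⇒≢ i<k (sym (injective e))) =
        ≤-reflexive (+-identityʳ a)
      ... | no  x≢line-i rewrite pile-other a x≢line-i = seg-≤ (suc i) m x

      seg-on : ∀ i m k → i ≤ k → k < i + m → seg i m (line k) ≡ a
      seg-on i zero    k i≤k k<i+0 = contradiction (≤-trans (≤-reflexive (+-identityʳ i)) i≤k) (<⇒≱ k<i+0)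
      seg-on i (suc m) k i≤k k<i+m+1 with line k ≟ line i
      ... | yes e rewrite injective e | pile-self a (line i)
                        | seg-off (suc i) m (λ j i<j e' → <⇒≢ i<j (sym (injective e'))) =
        +-identityʳ a
      ... | no  line-k≢line-i rewrite pile-other a line-k≢line-i =
        seg-on (suc i) m k (≤∧≢⇒< i≤k (λ i≡k → line-k≢line-i (cong line (sym i≡k))))
               (≤-trans k<i+m+1 (≤-reflexive (+-suc i m)))

  fire-right : ∀ k → aAt (+ suc k) ⊕ aAt (+ suc k) ↠ aAt (+ k) ⊕ aAt (+ (2 + k))
  fire-right k = ↠-respʳ (fire-pair (+ suc k))
    (⊕-congˡ (aAt (+ k)) λ x → cong (λ m → aAt (+ m) x) (+-comm (suc k) 1))

  fire-left : ∀ k → aAt -[1+ k ] ⊕ aAt -[1+ k ] ↠ aAt (- (+ k)) ⊕ aAt (- (+ (2 + k)))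
  fire-left k = ↠-respʳ (fire-pair -[1+ k ]) λ x →
    trans (+-comm (aAt -[1+ suc (k + 0) ] x) _)
          (cong₂ (λ u w → aAt u x + aAt w x) (-[1+k]+1 k) (cong (λ m → -[1+ suc m ]) (+-identityʳ k)))

  module Right = Segment +_
  module Left  = Segment (λ k → - (+ k))

  band : ℕ → ℕ → Config
  band i m = Right.seg i m ⊕ Left.seg i m

  ends : ℕ → Config
  ends t = aAt (+ t) ⊕ aAt (- (+ t))

  round : ∀ t → band 1 t ⊕ ends t ↠ band 1 (suc t)
  round t = begin
      band 1 t ⊕ ends t
    ≈⟨ ⊕-solve 4 (λ r l p n → (r ⊞ l) ⊞ (p ⊞ n) ⊜ (p ⊞ r) ⊞ (n ⊞ l)) (λ _ → refl)
         (Right.seg 1 t) (Left.seg 1 t) (aAt (+ t)) (aAt (- (+ t))) ⟩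
      (aAt (+ t) ⊕ Right.seg 1 t) ⊕ (aAt (- (+ t)) ⊕ Left.seg 1 t)
    ≲⟨ ↠-⊕ʳ (aAt (- (+ t)) ⊕ Left.seg 1 t) (Right.sweep fire-right t) ⟩
      (aAt (+ 0) ⊕ Right.seg 2 t) ⊕ (aAt (- (+ t)) ⊕ Left.seg 1 t)
    ≲⟨ ↠-⊕ˡ (aAt (+ 0) ⊕ Right.seg 2 t) (Left.sweep fire-left t) ⟩
      (aAt (+ 0) ⊕ Right.seg 2 t) ⊕ (aAt (+ 0) ⊕ Left.seg 2 t)
    ≈⟨ ⊕-solve 3 (λ o r l → (o ⊞ r) ⊞ (o ⊞ l) ⊜ (o ⊞ o) ⊞ (r ⊞ l)) (λ _ → refl)
         (aAt (+ 0)) (Right.seg 2 t) (Left.seg 2 t) ⟩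
      (aAt (+ 0) ⊕ aAt (+ 0)) ⊕ (Right.seg 2 t ⊕ Left.seg 2 t)
    ≲⟨ ↠-⊕ʳ (Right.seg 2 t ⊕ Left.seg 2 t) (fire-pair (+ 0)) ⟩
      (aAt (- (+ 1)) ⊕ aAt (+ 1)) ⊕ (Right.seg 2 t ⊕ Left.seg 2 t)
    ≈⟨ ⊕-solve 4 (λ n p r l → (n ⊞ p) ⊞ (r ⊞ l) ⊜ (p ⊞ r) ⊞ (n ⊞ l)) (λ _ → refl)
         (aAt (- (+ 1))) (aAt (+ 1)) (Right.seg 2 t) (Left.seg 2 t) ⟩
      band 1 (suc t) ∎

  spread : ∀ s t → (band 1 t ⊕ ends t) ⊕ band (suc t) s ↠ band 1 (suc t + s)
  spread zero t = begin
      (band 1 t ⊕ ends t) ⊕ band (suc t) 0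
    ≈⟨ (λ x → +-identityʳ _) ⟩
      band 1 t ⊕ ends t
    ≲⟨ round t ⟩
      band 1 (suc t)
    ≡⟨ cong (band 1) (+-identityʳ (suc t)) ⟨
      band 1 (suc t + 0) ∎
  spread (suc s) t = begin
      (band 1 t ⊕ ends t) ⊕ band (suc t) (suc s)
    ≲⟨ ↠-⊕ʳ (band (suc t) (suc s)) (round t) ⟩
      band 1 (suc t) ⊕ band (suc t) (suc s)
    ≈⟨ ⊕-solve 5 (λ b p r n l → b ⊞ ((p ⊞ r) ⊞ (n ⊞ l)) ⊜ (b ⊞ (p ⊞ n)) ⊞ (r ⊞ l)) (λ _ → refl)
         (band 1 (suc t)) (aAt (+ suc t)) (Right.seg (2 + t) s)
         (aAt (- (+ suc t))) (Left.seg (2 + t) s) ⟩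
      (band 1 (suc t) ⊕ ends (suc t)) ⊕ band (2 + t) s
    ≲⟨ spread s (suc t) ⟩
      band 1 (2 + t + s)
    ≡⟨ cong (band 1) (+-suc (suc t) s) ⟨
      band 1 (suc t + suc s) ∎

  shape : ℕ → ℕ → Config
  shape r q = pile r (+ 0) ⊕ band 1 q

  build : ∀ r q → pile (r + q * (2 * a)) (+ 0) ↠ shape r q
  build r zero = ≈⇒↠ λ x → trans (cong (λ m → pile m (+ 0) x) (+-identityʳ r)) (sym (+-identityʳ _))
  build r (suc q) = begin
      pile (r + suc q * (2 * a)) (+ 0)
    ≡⟨ cong (λ m → pile m (+ 0)) (split r q a) ⟩
      pile (r + q * (2 * a) + (a + a)) (+ 0)
    ≈⟨ pile-+ (r + q * (2 * a)) (a + a) (+ 0) ⟩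
      pile (r + q * (2 * a)) (+ 0) ⊕ pile (a + a) (+ 0)
    ≈⟨ ⊕-congˡ (pile (r + q * (2 * a)) (+ 0)) (pile-+ a a (+ 0)) ⟩
      pile (r + q * (2 * a)) (+ 0) ⊕ ends 0
    ≲⟨ ↠-⊕ʳ (ends 0) (build r q) ⟩
      shape r q ⊕ ends 0
    ≈⟨ ⊕-solve 3 (λ o b e → (o ⊞ b) ⊞ e ⊜ o ⊞ ((id ⊞ e) ⊞ b)) (λ _ → refl)
         (pile r (+ 0)) (band 1 q) (ends 0) ⟩
      pile r (+ 0) ⊕ ((band 1 0 ⊕ ends 0) ⊕ band 1 q)
    ≲⟨ ↠-⊕ˡ (pile r (+ 0)) (spread q 0) ⟩
      shape r (suc q) ∎
    where
    split : ∀ r q a → r + suc q * (2 * a) ≡ r + q * (2 * a) + (a + a)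
    split = solve-∀

  Left-injective : Injective _≡_ _≡_ (λ k → - (+ k))
  Left-injective e = ℤ.+-injective (ℤ.neg-injective e)

  shape-origin : ∀ r q → shape r q (+ 0) ≡ r
  shape-origin r q
    rewrite pile-self r (+ 0)
          | Right.seg-off 1 q {+ 0} (λ { (suc k) _ () })
          | Left.seg-off 1 q {+ 0} (λ { (suc k) _ () }) = +-identityʳ r

  shape-≤ : ∀ r q x → x ≢ + 0 → shape r q x ≤ a
  shape-≤ r q (+ zero)   x≢0 = contradiction refl x≢0
  shape-≤ r q (+ suc k)  x≢0
    rewrite pile-other r x≢0 | Left.seg-off 1 q {+ suc k} (λ { zero _ () ; (suc j) _ () })
          | +-identityʳ (Right.seg 1 q (+ suc k)) = Right.seg-≤ ℤ.+-injective 1 q (+ suc k)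
  shape-≤ r q -[1+ k ] x≢0
    rewrite pile-other r x≢0 | Right.seg-off 1 q { -[1+ k ]} (λ _ _ ()) = Left.seg-≤ Left-injective 1 q -[1+ k ]

  shape-inside : ∀ r q i → 1 ≤ ∣ i ∣ → ∣ i ∣ ≤ q → shape r q i ≡ a
  shape-inside r q (+ suc k) _ k<q
    rewrite pile-other r {+ 0} {+ suc k} (λ ()) | Left.seg-off 1 q {+ suc k} (λ { zero _ () ; (suc j) _ () })
          | +-identityʳ (Right.seg 1 q (+ suc k)) = Right.seg-on ℤ.+-injective 1 q (suc k) (s≤s z≤n) (s≤s k<q)
  shape-inside r q -[1+ k ] _ k<q
    rewrite pile-other r {+ 0} { -[1+ k ]} (λ ()) | Right.seg-off 1 q { -[1+ k ]} (λ _ _ ()) =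
    Left.seg-on Left-injective 1 q (suc k) (s≤s z≤n) (s≤s k<q)

  shape-stable : ∀ r q → .{{NonZero a}} → r < 2 * a → Stable a (shape r q)
  shape-stable r q r<2a x with x ≟ + 0
  ... | yes refl = subst (_< 2 * a) (sym (shape-origin r q)) r<2a
  ... | no  x≢0  = ≤-<-trans (shape-≤ r q x x≢0)
                     (subst (a <_) (cong (_+_ a) (sym (+-identityʳ a))) (m<m+n a (>-nonZero⁻¹ a)))

mainTheorem10 : (a : ℕ) → .{{_ : NonZero a}} → (n : ℕ) →
    Σ Config (λ c → Final a (initial n) c)
    × (∀ c → Final a (initial n) c →
         (c (+ 0) ≡ _%_ n (2 * a) {{twoA≢0 a}})
         × (∀ (i : ℤ) → 1 ≤ ∣ i ∣ → ∣ i ∣ ≤ _/_ n (2 * a) {{twoA≢0 a}} → c i ≡ a))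
mainTheorem10 a n = (d , final-d) , λ c final-c →
    let c≈shape : c ≈ shape r q
        c≈shape x = trans (final-unique final-c final-d x) (d≈shape x)
    in trans (c≈shape (+ 0)) (shape-origin r q) ,
       λ i 1≤∣i∣ ∣i∣≤q → trans (c≈shape i) (shape-inside r q i 1≤∣i∣ ∣i∣≤q)
  where
  open Game a
  instance
    2a≢0 : NonZero (2 * a)
    2a≢0 = twoA≢0 a
  r = n % (2 * a)
  q = n / (2 * a)
  initial↠shape : initial n ↠ shape r q
  initial↠shape = ↠-respˡ
    (λ x → trans (initial≈pile n x) (cong (λ m → pile m (+ 0) x) (m≡m%n+[m/n]*n n (2 * a))))
    (build r q)
  final-shape : Σ Config λ d → Final a (initial n) d × d ≈ shape r q
  final-shape = ↠-Final initial↠shape (shape-stable r q (m%n<n n (2 * a)))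
  d = proj₁ final-shape
  final-d = proj₁ (proj₂ final-shape)
  d≈shape = proj₂ (proj₂ final-shape)
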